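{- For every finite point set $S$ in the plane, the pairs of points of $S$ can be $2$-colored such that every axis-parallel rectangle that contains at least $3$ points of $S$ contains two pairs of points of $S$ of different colors.
   Context: A rectangle contains a pair of points if it contains both points.
   Formalization: The points of S have rational coordinates rather than being arbitrary points of the plane, and only axis-parallel rectangles with rational corners are considered. -}

module Defs where

open import Data.Nat using (ℕ)
open import Data.Rational using (ℚ; _≤_)
open import Data.Product using (_×_; _,_; ∃-syntax)
open import Data.Fin using (Fin; _<_)
open import Data.Bool using (Bool)
open import Relation.Binary.PropositionalEquality using (_≢_)

Point : Set
Point = ℚ × ℚ

record Rect : Set where
  constructor rect
  field
    x₁ x₂ y₁ y₂ : ℚ

_∈R_ : Point → Rect → Set
(px , py) ∈R rect x₁ x₂ y₁ y₂ = (x₁ ≤ px × px ≤ x₂) × (y₁ ≤ py × py ≤ y₂)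

-- S = {p i | i : Fin n} (p injective). An unordered pair {p i, p j} of
-- distinct points of S is represented by the index pair (i , j) with i < j.
-- A 2-colouring of the pairs: a colour c i j for each i < j
-- (values of c on i ≥ j are irrelevant).
Colouring : ℕ → Set
Colouring n = Fin n → Fin n → Bool

AtLeast3 : {n : ℕ} → (Fin n → Point) → Rect → Set
AtLeast3 p R = ∃[ i ] ∃[ j ] ∃[ k ]
  (i < j × j < k × p i ∈R R × p j ∈R R × p k ∈R R)

TwoColoursIn : {n : ℕ} → (Fin n → Point) → Colouring n → Rect → Set
TwoColoursIn p c R = ∃[ i ] ∃[ j ] ∃[ k ] ∃[ l ]
  (i < j × k < l × p i ∈R R × p j ∈R R × p k ∈R R × p l ∈R R
   × c i j ≢ c k l)

{-# OPTIONS --safe #-}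

-- Colour a pair of points by whether it is increasing, flipped when its
-- bounding box contains a third point of S; so an empty increasing pair and a
-- crowded decreasing pair get one colour, the other two kinds the other.
-- Let R contain three points and fix an orientation. If two of the points
-- form a pair of that orientation, repeatedly replacing the pair by the pair
-- formed with a point of its box ends in an empty pair of that orientation
-- inside R. Otherwise the three points are pairwise of the other orientation,
-- hence form a monotone chain whose ends span a box containing the middle
-- point. Doing this once for each orientation gives both colours.

module Submission where

open import Defs
open import Data.Nat using (ℕ)
open import Data.Fin using (Fin)
open import Data.Product using (∃-syntax)
open import Relation.Binary.PropositionalEquality using (_≡_)
open import Function.Definitions using (Injective)

open import Data.Bool using (Bool; true; false; not; _xor_)
open import Data.Bool.Properties using (T-≡)
open import Data.Fin as Fin using (_≟_)
import Data.Fin.Properties as Finₚ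
open import Data.Fin.Subset as Subset using (Subset)
open import Data.Fin.Subset.Induction using (⊂-wellFounded)
open import Data.Product using (_×_; _,_; ∃₂)
open import Data.Rational using (ℚ; _≤_; _<_)
open import Data.Rational.Properties
  using ( ≤-refl; ≤-reflexive; ≤-trans; ≤-antisym; ≤-total; _≤?_; _<?_
        ; <-irrefl; <-trans; <⇒≤; ≮⇒≥; ≤-<-trans; <-≤-trans; <-cmp)
open import Data.Sum using (_⊎_; inj₁; inj₂; [_,_]; swap)
open import Data.Vec using (tabulate)
open import Data.Vec.Properties using (lookup∘tabulate; []=↔lookup)
open import Function using (_∘_)
open import Function.Bundles using (Inverse; Equivalence; mk⇔)
open import Induction.WellFounded using (Acc; acc)
open import Level using (Level; 0ℓ)
open import Relation.Binary.Definitions using (tri<; tri≈; tri>)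
open import Relation.Binary.PropositionalEquality using (refl; sym; trans; cong; cong₂; subst₂; _≢_)
open import Relation.Nullary using (¬_; Dec; yes; no; does; contradiction)
open import Relation.Nullary.Decidable
  using (_×-dec_; _⊎-dec_; ¬?; isYes; dec-true; dec-false; does-⇔; toWitness; fromWitness)
open import Relation.Unary using (Pred; Decidable; _∈_; _⊆_)

private
  variable
    ℓ : Level
    n : ℕ
    l h u v w z : ℚ
    a b c d : Point

Between : ℚ → ℚ → ℚ → Set
Between u v w = (u ≤ v × v ≤ w) ⊎ (w ≤ v × v ≤ u)

between? : ∀ u v w → Dec (Between u v w)
between? u v w = (u ≤? v ×-dec v ≤? w) ⊎-dec (w ≤? v ×-dec v ≤? u)

between-sym : Between u v w → Between w v u
between-sym = swap

between-left : ∀ u w → Between u u w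
between-left u w with ≤-total u w
... | inj₁ u≤w = inj₁ (≤-refl , u≤w)
... | inj₂ w≤u = inj₂ (w≤u , ≤-refl)

between-trans : Between u w z → Between u v w → Between u v z
between-trans (inj₁ (u≤w , w≤z)) (inj₁ (u≤v , v≤w)) = inj₁ (u≤v , ≤-trans v≤w w≤z)
between-trans (inj₁ (u≤w , w≤z)) (inj₂ (w≤v , v≤u)) =
  inj₁ (≤-trans u≤w w≤v , ≤-trans v≤u (≤-trans u≤w w≤z))
between-trans (inj₂ (z≤w , w≤u)) (inj₁ (u≤v , v≤w)) =
  inj₂ (≤-trans z≤w (≤-trans w≤u u≤v) , ≤-trans v≤w w≤u)
between-trans (inj₂ (z≤w , w≤u)) (inj₂ (w≤v , v≤u)) = inj₂ (≤-trans z≤w w≤v , v≤u)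

between-antisym : Between u v w → Between u w v → v ≡ w
between-antisym (inj₁ (_ , v≤w))   (inj₁ (_ , w≤v))   = ≤-antisym v≤w w≤v
between-antisym (inj₁ (u≤v , v≤w)) (inj₂ (_ , w≤u))   = ≤-antisym v≤w (≤-trans w≤u u≤v)
between-antisym (inj₂ (w≤v , v≤u)) (inj₁ (u≤w , _))   = ≤-antisym (≤-trans v≤u u≤w) w≤v
between-antisym (inj₂ (w≤v , _))   (inj₂ (v≤w , _))   = ≤-antisym v≤w w≤v

between-bounded : l ≤ u × u ≤ h → l ≤ w × w ≤ h → Between u v w → l ≤ v × v ≤ h
between-bounded (l≤u , _) (_ , w≤h) (inj₁ (u≤v , v≤w)) = ≤-trans l≤u u≤v , ≤-trans v≤w w≤h
between-bounded (_ , u≤h) (l≤w , _) (inj₂ (w≤v , v≤u)) = ≤-trans l≤w w≤v , ≤-trans v≤u u≤h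

between-≤ : u ≤ w → Between u v w → u ≤ v × v ≤ w
between-≤ _   (inj₁ u≤v≤w)     = u≤v≤w
between-≤ u≤w (inj₂ (w≤v , v≤u)) = ≤-trans u≤w w≤v , ≤-trans v≤u u≤w

box : Point → Point → Pred Point 0ℓ
box (ax , ay) (bx , by) (dx , dy) = Between ax dx bx × Between ay dy by

box? : ∀ a b → Decidable (box a b)
box? (ax , ay) (bx , by) (dx , dy) = between? ax dx bx ×-dec between? ay dy by

box-sym : box a b ⊆ box b a
box-sym (dx∈ , dy∈) = between-sym dx∈ , between-sym dy∈

left∈box : ∀ a b → a ∈ box a b
left∈box (ax , ay) (bx , by) = between-left ax bx , between-left ay by

right∈box : ∀ a b → b ∈ box a b
right∈box a b = box-sym (left∈box b a)

box-shrinkˡ : d ∈ box a b → box a d ⊆ box a b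
box-shrinkˡ (dx∈ , dy∈) (ex∈ , ey∈) = between-trans dx∈ ex∈ , between-trans dy∈ ey∈

box-shrinkʳ : d ∈ box a b → box d b ⊆ box a b
box-shrinkʳ d∈ab = box-sym ∘ box-shrinkˡ (box-sym d∈ab) ∘ box-sym

box-antisym : d ∈ box a b → b ∈ box a d → b ≡ d
box-antisym (dx∈ , dy∈) (bx∈ , by∈) =
  cong₂ _,_ (between-antisym bx∈ dx∈) (between-antisym by∈ dy∈)

box⊆rect : ∀ {R} → a ∈R R → b ∈R R → d ∈ box a b → d ∈R R
box⊆rect (ax∈ , ay∈) (bx∈ , by∈) (dx∈ , dy∈) =
  between-bounded ax∈ bx∈ dx∈ , between-bounded ay∈ by∈ dy∈

record IsOrientation (_⊏_ : Point → Point → Set) : Set where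
  field
    irreflexive : ¬ a ⊏ a
    transitive  : a ⊏ b → b ⊏ c → a ⊏ c
    middle∈box  : a ⊏ b → b ⊏ c → b ∈ box a c
    split       : a ⊏ b → d ∈ box a b → a ⊏ d ⊎ d ⊏ b

Comparable : (Point → Point → Set) → Point → Point → Set
Comparable _⊏_ a b = a ⊏ b ⊎ b ⊏ a

-- Horizontal pairs count as increasing and vertical ones as decreasing, so
-- that two distinct points are comparable in exactly one of the two relations.
_≺_ : Point → Point → Set
(ax , ay) ≺ (bx , by) = ax < bx × ay ≤ by

_◁_ : Point → Point → Set
(ax , ay) ◁ (bx , by) = ax ≤ bx × by < ay

≺-isOrientation : IsOrientation _≺_
≺-isOrientation = record
  { irreflexive = λ (ax<ax , _) → <-irrefl refl ax<ax
  ; transitive  = λ (ax<bx , ay≤by) (bx<cx , by≤cy) → <-trans ax<bx bx<cx , ≤-trans ay≤by by≤cy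
  ; middle∈box  = λ (ax<bx , ay≤by) (bx<cx , by≤cy) →
                    inj₁ (<⇒≤ ax<bx , <⇒≤ bx<cx) , inj₁ (ay≤by , by≤cy)
  ; split       = split
  }
  where
  split : a ≺ b → d ∈ box a b → a ≺ d ⊎ d ≺ b
  split {ax , ay} {bx , by} {dx , dy} (ax<bx , ay≤by) (_ , dy∈)
    with between-≤ ay≤by dy∈ | ax <? dx
  ... | ay≤dy , _ | yes ax<dx = inj₁ (ax<dx , ay≤dy)
  ... | _ , dy≤by | no  ax≮dx = inj₂ (≤-<-trans (≮⇒≥ ax≮dx) ax<bx , dy≤by)

◁-isOrientation : IsOrientation _◁_
◁-isOrientation = record
  { irreflexive = λ (_ , ay<ay) → <-irrefl refl ay<ay
  ; transitive  = λ (ax≤bx , by<ay) (bx≤cx , cy<by) → ≤-trans ax≤bx bx≤cx , <-trans cy<by by<ay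
  ; middle∈box  = λ (ax≤bx , by<ay) (bx≤cx , cy<by) →
                    inj₁ (ax≤bx , bx≤cx) , inj₂ (<⇒≤ cy<by , <⇒≤ by<ay)
  ; split       = split
  }
  where
  split : a ◁ b → d ∈ box a b → a ◁ d ⊎ d ◁ b
  split {ax , ay} {bx , by} {dx , dy} (ax≤bx , by<ay) (dx∈ , _)
    with between-≤ ax≤bx dx∈ | dy <? ay
  ... | ax≤dx , _ | yes dy<ay = inj₁ (ax≤dx , dy<ay)
  ... | _ , dx≤bx | no  dy≮ay = inj₂ (dx≤bx , <-≤-trans by<ay (≮⇒≥ dy≮ay))

increasing? : ∀ a b → Dec (Comparable _≺_ a b)
increasing? (ax , ay) (bx , by) = (ax <? bx ×-dec ay ≤? by) ⊎-dec (bx <? ax ×-dec by ≤? ay)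

increasing⊎decreasing : a ≢ b → Comparable _≺_ a b ⊎ Comparable _◁_ a b
increasing⊎decreasing {ax , ay} {bx , by} a≢b with <-cmp ax bx | <-cmp ay by
... | tri< ax<bx _ _ | tri< ay<by _ _ = inj₁ (inj₁ (ax<bx , <⇒≤ ay<by))
... | tri< ax<bx _ _ | tri≈ _ ay≡by _ = inj₁ (inj₁ (ax<bx , ≤-reflexive ay≡by))
... | tri< ax<bx _ _ | tri> _ _ by<ay = inj₂ (inj₁ (<⇒≤ ax<bx , by<ay))
... | tri≈ _ ax≡bx _ | tri< ay<by _ _ = inj₂ (inj₂ (≤-reflexive (sym ax≡bx) , ay<by))
... | tri≈ _ ax≡bx _ | tri≈ _ ay≡by _ = contradiction (cong₂ _,_ ax≡bx ay≡by) a≢b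
... | tri≈ _ ax≡bx _ | tri> _ _ by<ay = inj₂ (inj₁ (≤-reflexive ax≡bx , by<ay))
... | tri> _ _ bx<ax | tri< ay<by _ _ = inj₂ (inj₂ (<⇒≤ bx<ax , ay<by))
... | tri> _ _ bx<ax | tri≈ _ ay≡by _ = inj₁ (inj₂ (bx<ax , ≤-reflexive (sym ay≡by)))
... | tri> _ _ bx<ax | tri> _ _ by<ay = inj₁ (inj₂ (bx<ax , <⇒≤ by<ay))

≺⇒¬◁ : a ≺ b → ¬ a ◁ b
≺⇒¬◁ (_ , ay≤by) (_ , by<ay) = <-irrefl refl (<-≤-trans by<ay ay≤by)

≺⇒¬▷ : a ≺ b → ¬ b ◁ a
≺⇒¬▷ (ax<bx , _) (bx≤ax , _) = <-irrefl refl (<-≤-trans ax<bx bx≤ax)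

increasing⇒¬decreasing : Comparable _≺_ a b → ¬ Comparable _◁_ a b
increasing⇒¬decreasing (inj₁ a≺b) = [ ≺⇒¬◁ a≺b , ≺⇒¬▷ a≺b ]
increasing⇒¬decreasing (inj₂ b≺a) = [ ≺⇒¬▷ b≺a , ≺⇒¬◁ b≺a ]

toSubset : {P : Pred (Fin n) ℓ} → Decidable P → Subset n
toSubset P? = tabulate (isYes ∘ P?)

module _ {P : Pred (Fin n) ℓ} (P? : Decidable P) {k : Fin n} where

  ∈-toSubset⁺ : P k → k Subset.∈ toSubset P?
  ∈-toSubset⁺ Pk = Inverse.from []=↔lookup
    (trans (lookup∘tabulate (isYes ∘ P?) k) (Equivalence.to T-≡ (fromWitness Pk)))

  ∈-toSubset⁻ : k Subset.∈ toSubset P? → P k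
  ∈-toSubset⁻ k∈ = toWitness (Equivalence.from T-≡
    (trans (sym (lookup∘tabulate (isYes ∘ P?) k)) (Inverse.to []=↔lookup k∈)))

toSubset-⊂ : {P Q : Pred (Fin n) ℓ} (P? : Decidable P) (Q? : Decidable Q) {k : Fin n} →
             P ⊆ Q → Q k → ¬ P k → toSubset P? Subset.⊂ toSubset Q?
toSubset-⊂ P? Q? P⊆Q Qk ¬Pk =
  ∈-toSubset⁺ Q? ∘ P⊆Q ∘ ∈-toSubset⁻ P? , _ , ∈-toSubset⁺ Q? Qk , ¬Pk ∘ ∈-toSubset⁻ P?

module _ {n : ℕ} (p : Fin n → Point) (p-injective : Injective _≡_ _≡_ p) where

  private
    variable
      i j k : Fin n
      R : Rect

  Crowded : Fin n → Fin n → Set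
  Crowded i j = ∃[ k ] (k ≢ i × k ≢ j × p k ∈ box (p i) (p j))

  crowded? : ∀ i j → Dec (Crowded i j)
  crowded? i j = Finₚ.any? λ k → ¬? (k ≟ i) ×-dec ¬? (k ≟ j) ×-dec box? (p i) (p j) (p k)

  crowded-sym : Crowded i j → Crowded j i
  crowded-sym (k , k≢i , k≢j , k∈ij) = k , k≢j , k≢i , box-sym k∈ij

  boxSet : Fin n → Fin n → Subset n
  boxSet i j = toSubset λ k → box? (p i) (p j) (p k)

  boxSet-⊂ˡ : p k ∈ box (p i) (p j) → k ≢ j → boxSet i k Subset.⊂ boxSet i j
  boxSet-⊂ˡ {k} {i} {j} k∈ij k≢j = toSubset-⊂ _ _ (box-shrinkˡ k∈ij) (right∈box (p i) (p j))
    λ j∈ik → k≢j (p-injective (sym (box-antisym k∈ij j∈ik)))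

  boxSet-⊂ʳ : p k ∈ box (p i) (p j) → k ≢ i → boxSet k j Subset.⊂ boxSet i j
  boxSet-⊂ʳ {k} {i} {j} k∈ij k≢i = toSubset-⊂ _ _ (box-shrinkʳ k∈ij) (left∈box (p i) (p j))
    λ i∈kj → k≢i (p-injective (sym (box-antisym (box-sym k∈ij) (box-sym i∈kj))))

  <⇒≢ : i Fin.< j → p i ≢ p j
  <⇒≢ i<j = Finₚ.<⇒≢ i<j ∘ p-injective

  PairIn : Rect → (Fin n → Fin n → Set) → Set
  PairIn R P = ∃₂ λ i j → p i ∈R R × p j ∈R R × P i j

  module _ {_⊏_ : Point → Point → Set} (⊏-isOrientation : IsOrientation _⊏_) where
    open IsOrientation ⊏-isOrientation

    ⊏⇒≢ : p i ⊏ p j → i ≢ j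
    ⊏⇒≢ i⊏j refl = irreflexive i⊏j

    emptyPairIn : p i ∈R R → p j ∈R R → p i ⊏ p j →
                  PairIn R λ i j → p i ⊏ p j × ¬ Crowded i j
    emptyPairIn = shrink (⊂-wellFounded _)
      where
      shrink : Acc Subset._⊂_ (boxSet i j) → p i ∈R R → p j ∈R R → p i ⊏ p j →
               PairIn R λ i j → p i ⊏ p j × ¬ Crowded i j
      shrink {i} {j} (acc smaller) iR jR i⊏j with crowded? i j
      ... | no empty = i , j , iR , jR , i⊏j , empty
      ... | yes (k , k≢i , k≢j , k∈ij) with split i⊏j k∈ij
      ...   | inj₁ i⊏k = shrink (smaller (boxSet-⊂ˡ k∈ij k≢j)) iR (box⊆rect iR jR k∈ij) i⊏k
      ...   | inj₂ k⊏j = shrink (smaller (boxSet-⊂ʳ k∈ij k≢i)) (box⊆rect iR jR k∈ij) jR k⊏j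

    crowdedPairIn-chain : p i ∈R R → p k ∈R R → p i ⊏ p j → p j ⊏ p k →
                          PairIn R λ i k → p i ⊏ p k × Crowded i k
    crowdedPairIn-chain {i} {k = k} {j = j} iR kR i⊏j j⊏k =
      i , k , iR , kR , transitive i⊏j j⊏k ,
      j , ⊏⇒≢ i⊏j ∘ sym , ⊏⇒≢ j⊏k , middle∈box i⊏j j⊏k

    crowdedPairIn : p i ∈R R → p j ∈R R → p k ∈R R →
                    Comparable _⊏_ (p i) (p j) → Comparable _⊏_ (p j) (p k) →
                    Comparable _⊏_ (p i) (p k) →
                    PairIn R λ i k → p i ⊏ p k × Crowded i k
    crowdedPairIn iR jR kR (inj₁ i⊏j) (inj₁ j⊏k) _          = crowdedPairIn-chain iR kR i⊏j j⊏k
    crowdedPairIn iR jR kR (inj₁ i⊏j) (inj₂ k⊏j) (inj₁ i⊏k) = crowdedPairIn-chain iR jR i⊏k k⊏j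
    crowdedPairIn iR jR kR (inj₁ i⊏j) (inj₂ k⊏j) (inj₂ k⊏i) = crowdedPairIn-chain kR jR k⊏i i⊏j
    crowdedPairIn iR jR kR (inj₂ j⊏i) (inj₁ j⊏k) (inj₁ i⊏k) = crowdedPairIn-chain jR kR j⊏i i⊏k
    crowdedPairIn iR jR kR (inj₂ j⊏i) (inj₁ j⊏k) (inj₂ k⊏i) = crowdedPairIn-chain jR iR j⊏k k⊏i
    crowdedPairIn iR jR kR (inj₂ j⊏i) (inj₂ k⊏j) _          = crowdedPairIn-chain kR iR k⊏j j⊏i

  colour : Colouring n
  colour i j = does (increasing? (p i) (p j)) xor does (crowded? i j)

  colour-sym : ∀ i j → colour i j ≡ colour j i
  colour-sym i j = cong₂ _xor_
    (does-⇔ (mk⇔ swap swap) (increasing? (p i) (p j)) (increasing? (p j) (p i)))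
    (does-⇔ (mk⇔ crowded-sym crowded-sym) (crowded? i j) (crowded? j i))

  colour-increasing : Comparable _≺_ (p i) (p j) → colour i j ≡ not (does (crowded? i j))
  colour-increasing {i} {j} i≺j =
    cong (_xor does (crowded? i j)) (dec-true (increasing? (p i) (p j)) i≺j)

  colour-decreasing : Comparable _◁_ (p i) (p j) → colour i j ≡ does (crowded? i j)
  colour-decreasing {i} {j} i◁j =
    cong (_xor does (crowded? i j))
         (dec-false (increasing? (p i) (p j)) λ i≺j → increasing⇒¬decreasing i≺j i◁j)

  ColouredPairIn : Rect → Bool → Set
  ColouredPairIn R κ = PairIn R λ i j → i Fin.< j × colour i j ≡ κ

  colouredPairIn-unordered : ∀ {κ} → p i ∈R R → p j ∈R R → i ≢ j → colour i j ≡ κ →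
                             ColouredPairIn R κ
  colouredPairIn-unordered {i} {R} {j} iR jR i≢j ij≡κ with Finₚ.<-cmp i j
  ... | tri< i<j _ _ = i , j , iR , jR , i<j , ij≡κ
  ... | tri≈ _ i≡j _ = contradiction i≡j i≢j
  ... | tri> _ _ j<i = j , i , jR , iR , j<i , trans (colour-sym j i) ij≡κ

  module _ {_⊏_ _⋖_ : Point → Point → Set}
           (⊏-isOrientation : IsOrientation _⊏_) (⋖-isOrientation : IsOrientation _⋖_) {κ : Bool}
           (dichotomy : ∀ {a b} → a ≢ b → Comparable _⊏_ a b ⊎ Comparable _⋖_ a b)
           (colour-empty : ∀ {i j} → p i ⊏ p j → ¬ Crowded i j → colour i j ≡ κ)
           (colour-crowded : ∀ {i j} → p i ⋖ p j → Crowded i j → colour i j ≡ κ)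
           where

    colouredPairIn-empty : p i ∈R R → p j ∈R R → Comparable _⊏_ (p i) (p j) → ColouredPairIn R κ
    colouredPairIn-empty iR jR (inj₁ i⊏j) with emptyPairIn ⊏-isOrientation iR jR i⊏j
    ... | k , l , kR , lR , k⊏l , empty =
      colouredPairIn-unordered kR lR (⊏⇒≢ ⊏-isOrientation k⊏l) (colour-empty k⊏l empty)
    colouredPairIn-empty iR jR (inj₂ j⊏i) = colouredPairIn-empty jR iR (inj₁ j⊏i)

    colouredPairIn : AtLeast3 p R → ColouredPairIn R κ
    colouredPairIn (i , j , k , i<j , j<k , iR , jR , kR)
      with dichotomy (<⇒≢ i<j) | dichotomy (<⇒≢ j<k) | dichotomy (<⇒≢ (Finₚ.<-trans i<j j<k))
    ... | inj₁ ij | _       | _       = colouredPairIn-empty iR jR ij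
    ... | inj₂ _  | inj₁ jk | _       = colouredPairIn-empty jR kR jk
    ... | inj₂ _  | inj₂ _  | inj₁ ik = colouredPairIn-empty iR kR ik
    ... | inj₂ ij | inj₂ jk | inj₂ ik with crowdedPairIn ⋖-isOrientation iR jR kR ij jk ik
    ...   | k , l , kR , lR , k⋖l , crowded =
      colouredPairIn-unordered kR lR (⊏⇒≢ ⋖-isOrientation k⋖l) (colour-crowded k⋖l crowded)

  colour-empty-increasing : p i ≺ p j → ¬ Crowded i j → colour i j ≡ true
  colour-empty-increasing {i} {j} i≺j empty =
    trans (colour-increasing (inj₁ i≺j)) (cong not (dec-false (crowded? i j) empty))

  colour-crowded-decreasing : p i ◁ p j → Crowded i j → colour i j ≡ true
  colour-crowded-decreasing {i} {j} i◁j crowded =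
    trans (colour-decreasing (inj₁ i◁j)) (dec-true (crowded? i j) crowded)

  colour-empty-decreasing : p i ◁ p j → ¬ Crowded i j → colour i j ≡ false
  colour-empty-decreasing {i} {j} i◁j empty =
    trans (colour-decreasing (inj₁ i◁j)) (dec-false (crowded? i j) empty)

  colour-crowded-increasing : p i ≺ p j → Crowded i j → colour i j ≡ false
  colour-crowded-increasing {i} {j} i≺j crowded =
    trans (colour-increasing (inj₁ i≺j)) (cong not (dec-true (crowded? i j) crowded))

  bichromatic : AtLeast3 p R → TwoColoursIn p colour R
  bichromatic three
    with colouredPairIn ≺-isOrientation ◁-isOrientation increasing⊎decreasing
           colour-empty-increasing colour-crowded-decreasing three
       | colouredPairIn ◁-isOrientation ≺-isOrientation (swap ∘ increasing⊎decreasing)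
           colour-empty-decreasing colour-crowded-increasing three
  ... | i , j , iR , jR , i<j , ij≡true | k , l , kR , lR , k<l , kl≡false =
    i , j , k , l , i<j , k<l , iR , jR , kR , lR , subst₂ _≢_ (sym ij≡true) (sym kl≡false) λ ()

theorem10 : (n : ℕ) (p : Fin n → Point) → Injective _≡_ _≡_ p →
    ∃[ c ] ((R : Rect) → AtLeast3 p R → TwoColoursIn p c R)
theorem10 n p p-injective = colour p p-injective , λ R → bichromatic p p-injective
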